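{- Let $m\ge4$ be an integer and $p$ a prime, and suppose $\frac mp=\frac1x+\frac1y+\frac1z$ has a Type I solution $(x,y,z)\in\mathbb N^3$. Then there exist $a,d,f\in\mathbb N$ with $f\mid ma^2d+1$, $mad\mid p+f$, and $mad\le 2p+1$.
   Context: $\mathbb N$ denotes the positive integers. A solution $(x,y,z)\in\mathbb N^3$ of $\frac mn=\frac1x+\frac1y+\frac1z$ is of Type I if $n$ divides $x$ but $n$ is coprime to $y$ and to $z$. -}

module Defs where

open import Data.Nat using (ℕ; _+_; _*_; _<_)
open import Data.Nat.Divisibility using (_∣_)
open import Data.Nat.Coprimality using (Coprime)
open import Data.Product using (_×_)
open import Relation.Binary.PropositionalEquality using (_≡_)

-- The rational equation is stated with denominators cleared, which is
-- equivalent since n, x, y, z are positive:  m·x·y·z = n·(y·z + x·z + x·y).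
Solution : ℕ → ℕ → ℕ → ℕ → ℕ → Set
Solution m n x y z =
  (0 < x) × (0 < y) × (0 < z) × (m * x * y * z ≡ n * (y * z + x * z + x * y))

TypeI : ℕ → ℕ → ℕ → ℕ → ℕ → Set
TypeI m n x y z = Solution m n x y z × (n ∣ x) × Coprime n y × Coprime n z

-- Write x = q·p and y = a·g, z = b·g with g = gcd y z.  After cancelling p and g,
-- a and b both divide q, so q = d·a·b; cancelling a·b·g then shows d ∣ g, say
-- g = c·d.  This is the parametrisation x = p·a·b·d, y = a·c·d, z = b·c·d with
-- m·a·b·d·c = c + p·(a + b) and gcd(p, c) = 1.  Take a ≤ b and n = m·a·d.  Then
-- n·c > p, and f = n·c − p satisfies b·f = c + p·a, hence c·(a·n + 1) = (a + b)·f;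
-- a common divisor of f and c divides p = n·c − f, so f ∣ a·n + 1 = m·a²·d + 1.
-- Finally b·c·n = c + p·(a + b) ≤ b·c·(2p + 1).
module Submission where

open import Data.Nat
  using (ℕ; _+_; _*_; _∸_; _<_; _≤_; NonZero; >-nonZero; >-nonZero⁻¹; ≢-nonZero; ≢-nonZero⁻¹)
open import Data.Nat.Properties
open import Data.Nat.Divisibility
open import Data.Nat.Coprimality
  using (Coprime; coprime-divisor; coprime-+; coprime⇒gcd≡1; coprime-/gcd)
import Data.Nat.Coprimality as Coprimality
open import Data.Nat.GCD using (gcd; gcd[m,n]∣m; gcd[m,n]∣n; gcd[m,n]≢0)
open import Data.Nat.LCM using (lcm; lcm-least; gcd*lcm)
open import Data.Nat.DivMod using (_/_; m/n*n≡m)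
open import Data.Nat.Primality using (Prime; prime⇒nonZero)
open import Data.Nat.Tactic.RingSolver using (solve)
open import Data.List using (_∷_; [])
open import Data.Product using (_×_; _,_; ∃-syntax; proj₁; proj₂)
open import Data.Sum using (inj₁; [_,_]′)
open import Relation.Binary.PropositionalEquality
open import Defs

coprime-*-∣ : ∀ {m n o} → Coprime m n → m ∣ o → n ∣ o → m * n ∣ o
coprime-*-∣ {m} {n} m⊥n m∣o n∣o = subst (_∣ _) lcm≡m*n (lcm-least m∣o n∣o)
  where
  lcm≡m*n : lcm m n ≡ m * n
  lcm≡m*n = trans (sym (*-identityˡ (lcm m n)))
                  (trans (cong (_* lcm m n) (sym (coprime⇒gcd≡1 m⊥n))) (gcd*lcm m n))

coprime-part-∣ : ∀ {a b} g q .{{_ : NonZero g}} →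
                 Coprime a b → a * g ∣ q * (a * g + b * g) → a ∣ q
coprime-part-∣ {a} {b} g q a⊥b ag∣ =
  coprime-divisor a⊥a+b (*-cancelʳ-∣ g (subst (a * g ∣_) regroup ag∣))
  where
  a⊥a+b : Coprime a (a + b)
  a⊥a+b = Coprimality.sym (coprime-+ (Coprimality.sym a⊥b))
  regroup : q * (a * g + b * g) ≡ (a + b) * q * g
  regroup = solve (a ∷ b ∷ g ∷ q ∷ [])

record TypeIParametrisation (m p : ℕ) : Set where
  field
    a b c d  : ℕ
    {{a≢0}}  : NonZero a
    {{b≢0}}  : NonZero b
    {{c≢0}}  : NonZero c
    {{d≢0}}  : NonZero d
    p⊥c      : Coprime p c
    equation : m * a * b * d * c ≡ c + p * (a + b)

cancel-p : ∀ m p q y z .{{_ : NonZero p}} →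
           m * (q * p) * y * z ≡ p * (y * z + q * p * z + q * p * y) →
           m * q * y * z ≡ y * z + p * q * (y + z)
cancel-p m p q y z eq = *-cancelˡ-≡ _ _ p (begin
  p * (m * q * y * z)                   ≡⟨ solve (m ∷ p ∷ q ∷ y ∷ z ∷ []) ⟩
  m * (q * p) * y * z                   ≡⟨ eq ⟩
  p * (y * z + q * p * z + q * p * y)   ≡⟨ solve (p ∷ q ∷ y ∷ z ∷ []) ⟩
  p * (y * z + p * q * (y + z))         ∎)
  where open ≡-Reasoning

∣q*[y+z] : ∀ m q {p y z} → Coprime p y → Coprime p z →
           m * q * y * z ≡ y * z + p * q * (y + z) →
           y ∣ q * (y + z) × z ∣ q * (y + z)
∣q*[y+z] m q {p} {y} {z} p⊥y p⊥z eq =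
  coprime-divisor (Coprimality.sym p⊥y) (∣p*[q*[y+z]] (n∣m*n*o (m * q) z) (m∣m*n z)) ,
  coprime-divisor (Coprimality.sym p⊥z) (∣p*[q*[y+z]] (n∣m*n (m * q * y)) (n∣m*n y))
  where
  ∣p*[q*[y+z]] : ∀ {k} → k ∣ m * q * y * z → k ∣ y * z → k ∣ p * (q * (y + z))
  ∣p*[q*[y+z]] {k} k∣lhs k∣yz =
    subst (k ∣_) (*-assoc p q (y + z)) (∣m+n∣m⇒∣n (subst (k ∣_) eq k∣lhs) k∣yz)

cancel-abg : ∀ m p a b d g .{{_ : NonZero a}} .{{_ : NonZero b}} .{{_ : NonZero g}} →
             m * (d * (a * b)) * (a * g) * (b * g) ≡
               a * g * (b * g) + p * (d * (a * b)) * (a * g + b * g) →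
             m * a * b * d * g ≡ g + p * d * (a + b)
cancel-abg m p a b d g eq = *-cancelˡ-≡ _ _ (a * b * g) {{abg≢0}} (begin
  a * b * g * (m * a * b * d * g)
    ≡⟨ solve (m ∷ a ∷ b ∷ d ∷ g ∷ []) ⟩
  m * (d * (a * b)) * (a * g) * (b * g)
    ≡⟨ eq ⟩
  a * g * (b * g) + p * (d * (a * b)) * (a * g + b * g)
    ≡⟨ solve (p ∷ a ∷ b ∷ d ∷ g ∷ []) ⟩
  a * b * g * (g + p * d * (a + b))
    ∎)
  where
  open ≡-Reasoning
  abg≢0 : NonZero (a * b * g)
  abg≢0 = m*n≢0 (a * b) g {{m*n≢0 a b}}

d∣g : ∀ m p a b d g → m * a * b * d * g ≡ g + p * d * (a + b) → d ∣ g
d∣g m p a b d g eq =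
  ∣m+n∣m⇒∣n (subst (d ∣_) (trans eq (+-comm g _)) (n∣m*n*o (m * a * b) g))
            (n∣m*n*o p (a + b))

cancel-d : ∀ m p a b c d .{{_ : NonZero d}} →
           m * a * b * d * (c * d) ≡ c * d + p * d * (a + b) →
           m * a * b * d * c ≡ c + p * (a + b)
cancel-d m p a b c d eq = *-cancelˡ-≡ _ _ d (begin
  d * (m * a * b * d * c)   ≡⟨ solve (m ∷ a ∷ b ∷ c ∷ d ∷ []) ⟩
  m * a * b * d * (c * d)   ≡⟨ eq ⟩
  c * d + p * d * (a + b)   ≡⟨ solve (p ∷ a ∷ b ∷ c ∷ d ∷ []) ⟩
  d * (c + p * (a + b))     ∎)
  where open ≡-Reasoning

d∣g⇒parametrisation : ∀ {m p} a b d {g}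
                      {{_ : NonZero a}} {{_ : NonZero b}} {{_ : NonZero d}} {{_ : NonZero g}} →
                      d ∣ g → Coprime p g → m * a * b * d * g ≡ g + p * d * (a + b) →
                      TypeIParametrisation m p
d∣g⇒parametrisation {m} {p} a b d (divides c refl) p⊥cd eq = record
  { a = a ; b = b ; c = c ; d = d
  ; c≢0 = m*n≢0⇒m≢0 c
  ; p⊥c = λ (i∣p , i∣c) → p⊥cd (i∣p , ∣m⇒∣m*n d i∣c)
  ; equation = cancel-d m p a b c d eq
  }

factored⇒parametrisation : ∀ {m p q} a b g
                           {{_ : NonZero q}} {{_ : NonZero a}} {{_ : NonZero b}} {{_ : NonZero g}} →
                           a * b ∣ q → Coprime p g →
                           m * q * (a * g) * (b * g) ≡
                             a * g * (b * g) + p * q * (a * g + b * g) →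
                           TypeIParametrisation m p
factored⇒parametrisation {m} {p} a b g (divides d refl) p⊥g eq =
  d∣g⇒parametrisation a b d (d∣g m p a b d g reduced) p⊥g reduced
  where
  instance
    d≢0 : NonZero d
    d≢0 = m*n≢0⇒m≢0 d
  reduced : m * a * b * d * g ≡ g + p * d * (a + b)
  reduced = cancel-abg m p a b d g eq

split⇒parametrisation : ∀ {m p} q {y z} a b g
                        {{_ : NonZero q}} {{_ : NonZero y}} {{_ : NonZero z}} →
                        y ≡ a * g → z ≡ b * g → Coprime a b →
                        Coprime p y → Coprime p z →
                        m * q * y * z ≡ y * z + p * q * (y + z) → TypeIParametrisation m p
split⇒parametrisation {m} {p} q a b g refl refl a⊥b p⊥y p⊥z eq =
  factored⇒parametrisation a b g (coprime-*-∣ a⊥b a∣q b∣q) p⊥g eq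
  where
  instance
    a≢0 : NonZero a
    a≢0 = m*n≢0⇒m≢0 a
    b≢0 : NonZero b
    b≢0 = m*n≢0⇒m≢0 b
    g≢0 : NonZero g
    g≢0 = m*n≢0⇒n≢0 a
  a∣q : a ∣ q
  a∣q = coprime-part-∣ g q a⊥b (proj₁ (∣q*[y+z] m q p⊥y p⊥z eq))
  b∣q : b ∣ q
  b∣q = coprime-part-∣ g q (Coprimality.sym a⊥b)
          (subst (b * g ∣_) (cong (q *_) (+-comm (a * g) (b * g)))
                 (proj₂ (∣q*[y+z] m q p⊥y p⊥z eq)))
  p⊥g : Coprime p g
  p⊥g (i∣p , i∣g) = p⊥y (i∣p , ∣n⇒∣m*n a i∣g)

reduced⇒parametrisation : ∀ {m p} q y z {{_ : NonZero q}} {{_ : NonZero y}} {{_ : NonZero z}} →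
                          Coprime p y → Coprime p z →
                          m * q * y * z ≡ y * z + p * q * (y + z) → TypeIParametrisation m p
reduced⇒parametrisation q y z p⊥y p⊥z eq =
  split⇒parametrisation q (y / gcd y z) (z / gcd y z) (gcd y z)
    (sym (m/n*n≡m (gcd[m,n]∣m y z))) (sym (m/n*n≡m (gcd[m,n]∣n y z)))
    (coprime-/gcd y z) p⊥y p⊥z eq
  where
  instance
    gcd≢0 : NonZero (gcd y z)
    gcd≢0 = ≢-nonZero (gcd[m,n]≢0 y z (inj₁ (≢-nonZero⁻¹ y)))

typeI⇒parametrisation : ∀ {m p x y z} {{_ : NonZero p}} →
                        TypeI m p x y z → TypeIParametrisation m p
typeI⇒parametrisation {m} {p} {y = y} {z}
  ((x>0 , y>0 , z>0 , eq) , divides q refl , p⊥y , p⊥z) =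
  reduced⇒parametrisation q y z
    {{m*n≢0⇒m≢0 q {{>-nonZero x>0}}}} {{>-nonZero y>0}} {{>-nonZero z>0}}
    p⊥y p⊥z (cancel-p m p q y z eq)

swap : ∀ {m p} → TypeIParametrisation m p → TypeIParametrisation m p
swap {m} {p} record { a = a ; b = b ; c = c ; d = d ; p⊥c = p⊥c ; equation = equation } = record
  { a = b ; b = a ; c = c ; d = d ; p⊥c = p⊥c
  ; equation = begin
      m * b * a * d * c   ≡⟨ solve (m ∷ a ∷ b ∷ c ∷ d ∷ []) ⟩
      m * a * b * d * c   ≡⟨ equation ⟩
      c + p * (a + b)     ≡⟨ cong (λ s → c + p * s) (+-comm a b) ⟩
      c + p * (b + a)     ∎
  }
  where open ≡-Reasoning

p<n*c : ∀ n a b c p .{{_ : NonZero c}} → b * (n * c) ≡ c + p * (a + b) → p < n * c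
p<n*c n a b c p eq = *-cancelˡ-< b p (n * c) (begin-strict
  b * p             ≡⟨ *-comm b p ⟩
  p * b             <⟨ m<n+m (p * b) (>-nonZero⁻¹ c) ⟩
  c + p * b         ≤⟨ +-monoʳ-≤ c (*-monoʳ-≤ p (m≤n+m b a)) ⟩
  c + p * (a + b)   ≡⟨ sym eq ⟩
  b * (n * c)       ∎)
  where open ≤-Reasoning

p+f≡n*c⇒f∣a*n+1 : ∀ n a b c {p f} → Coprime p c → b * (n * c) ≡ c + p * (a + b) →
                  p + f ≡ n * c → f ∣ a * n + 1
p+f≡n*c⇒f∣a*n+1 n a b c {p} {f} p⊥c eq p+f≡nc =
  coprime-divisor f⊥c (divides (a + b) c[an+1]≡[a+b]f)
  where
  open ≡-Reasoning
  bf≡c+pa : b * f ≡ c + p * a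
  bf≡c+pa = +-cancelˡ-≡ (b * p) _ _ (begin
    b * p + b * f         ≡⟨ sym (*-distribˡ-+ b p f) ⟩
    b * (p + f)           ≡⟨ cong (b *_) p+f≡nc ⟩
    b * (n * c)           ≡⟨ eq ⟩
    c + p * (a + b)       ≡⟨ solve (a ∷ b ∷ c ∷ p ∷ []) ⟩
    b * p + (c + p * a)   ∎)
  c[an+1]≡[a+b]f : c * (a * n + 1) ≡ (a + b) * f
  c[an+1]≡[a+b]f = begin
    c * (a * n + 1)       ≡⟨ solve (a ∷ c ∷ n ∷ []) ⟩
    a * (n * c) + c       ≡⟨ cong (λ k → a * k + c) (sym p+f≡nc) ⟩
    a * (p + f) + c       ≡⟨ solve (a ∷ c ∷ f ∷ p ∷ []) ⟩
    a * f + (c + p * a)   ≡⟨ cong (a * f +_) (sym bf≡c+pa) ⟩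
    a * f + b * f         ≡⟨ sym (*-distribʳ-+ f a b) ⟩
    (a + b) * f           ∎
  f⊥c : Coprime f c
  f⊥c {i} (i∣f , i∣c) = p⊥c (∣m+n∣m⇒∣n i∣f+p i∣f , i∣c)
    where
    i∣f+p : i ∣ f + p
    i∣f+p = subst (i ∣_) (trans (sym p+f≡nc) (+-comm p f)) (∣n⇒∣m*n n i∣c)

n≤2*p+1 : ∀ n {a b} c p .{{_ : NonZero b}} .{{_ : NonZero c}} → a ≤ b →
          b * (n * c) ≡ c + p * (a + b) → n ≤ 2 * p + 1
n≤2*p+1 n {a} {b} c p a≤b eq = *-cancelˡ-≤ (b * c) {{m*n≢0 b c}} (begin
  b * c * n                 ≡⟨ solve (b ∷ c ∷ n ∷ []) ⟩
  b * (n * c)               ≡⟨ eq ⟩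
  c + p * (a + b)           ≤⟨ +-mono-≤ (m≤n*m c b) (*-monoʳ-≤ p (+-monoˡ-≤ b a≤b)) ⟩
  b * c + p * (b + b)       ≤⟨ +-monoʳ-≤ (b * c) (m≤m*n (p * (b + b)) c) ⟩
  b * c + p * (b + b) * c   ≡⟨ solve (b ∷ c ∷ p ∷ []) ⟩
  b * c * (2 * p + 1)       ∎)
  where open ≤-Reasoning

Conclusion : ℕ → ℕ → Set
Conclusion m p = ∃[ a ] ∃[ d ] ∃[ f ] ((0 < a) × (0 < d) × (0 < f) ×
  (f ∣ m * (a * a) * d + 1) × (m * a * d ∣ p + f) × (m * a * d ≤ 2 * p + 1))

parametrisation⇒conclusion : ∀ {m p} (P : TypeIParametrisation m p) →
                             TypeIParametrisation.a P ≤ TypeIParametrisation.b P →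
                             Conclusion m p
parametrisation⇒conclusion {m} {p}
  record { a = a ; b = b ; c = c ; d = d ; p⊥c = p⊥c ; equation = equation } a≤b =
  a , d , f , >-nonZero⁻¹ a , >-nonZero⁻¹ d , m<n⇒0<n∸m p<madc ,
  subst (f ∣_) (cong (_+ 1) a*mad≡m*[a*a]*d)
        (p+f≡n*c⇒f∣a*n+1 (m * a * d) a b c p⊥c shifted p+f≡madc) ,
  divides c (trans p+f≡madc (*-comm (m * a * d) c)) ,
  n≤2*p+1 (m * a * d) c p a≤b shifted
  where
  open ≡-Reasoning
  shifted : b * (m * a * d * c) ≡ c + p * (a + b)
  shifted = begin
    b * (m * a * d * c)   ≡⟨ solve (m ∷ a ∷ b ∷ c ∷ d ∷ []) ⟩
    m * a * b * d * c     ≡⟨ equation ⟩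
    c + p * (a + b)       ∎
  a*mad≡m*[a*a]*d : a * (m * a * d) ≡ m * (a * a) * d
  a*mad≡m*[a*a]*d = solve (m ∷ a ∷ d ∷ [])
  p<madc : p < m * a * d * c
  p<madc = p<n*c (m * a * d) a b c p shifted
  f : ℕ
  f = m * a * d * c ∸ p
  p+f≡madc : p + f ≡ m * a * d * c
  p+f≡madc = m+[n∸m]≡n (<⇒≤ p<madc)

lemma7p4 : (m p x y z : ℕ) → 4 ≤ m → Prime p → TypeI m p x y z →
    ∃[ a ] ∃[ d ] ∃[ f ] ((0 < a) × (0 < d) × (0 < f) ×
      (f ∣ m * (a * a) * d + 1) × (m * a * d ∣ p + f) × (m * a * d ≤ 2 * p + 1))
lemma7p4 m p x y z _ p-prime typeI =
  [ parametrisation⇒conclusion P , parametrisation⇒conclusion (swap P) ]′ (≤-total a b)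
  where
  P : TypeIParametrisation m p
  P = typeI⇒parametrisation {{prime⇒nonZero p-prime}} typeI
  open TypeIParametrisation P
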